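{- Suppose $\vec T$ satisfies Condition 1, 2 or 3 at every vertex of $H$ and satisfies Condition 2 at some vertex of $H$. Let $J$ be any connected component of $K$, and let $J'$ be the subgraph of $H$ consisting of all edges $a_{2i-1}a_{2i}$ for which $v_{2i-1}v_{2i}$ or $w_{2i-1}w_{2i}$ is an edge of $J$. Then $J'$ contains at least one of: (i) at least two vertices at which $\vec T$ satisfies Condition 2; (ii) a vertex of degree at least 2 in $J'$ at which $\vec T$ satisfies Condition 2; (iii) a vertex of degree at least 3 in $H$ at which $\vec T$ satisfies Condition 1 or Condition 3.
   Context: $H$ is a connected finite simple graph with no leaves, vertices $1,\dots,t$, $k$ edges, oriented arbitrarily with directed edges $\overrightarrow{a_1a_2},\dots,\overrightarrow{a_{2k-1}a_{2k}}$; $\Gamma(b)=\{i:a_i=b\}$. $G$ is a finite simple graph and $\vec G$ its symmetric digraph. $\vec T=(\vec T_1,\vec T_2)$ is a $2k$-tuple of edges of $\vec G$ with $\vec T_1=(\overrightarrow{v_1v_2},\dots,\overrightarrow{v_{2k-1}v_{2k}})$, $\vec T_2=(\overrightarrow{w_1w_2},\dots,\overrightarrow{w_{2k-1}w_{2k}})$. $K$ is the undirected subgraph of $G$ consisting of the edges $v_{2i-1}v_{2i}$ and $w_{2i-1}w_{2i}$. Conditions at a vertex $b$ of $H$: Condition 1: the $v_i$, $i\in\Gamma(b)$, are all equal and the $w_i$, $i\in\Gamma(b)$, are all equal. Condition 2: $v_i=w_i$ for all $i\in\Gamma(b)$. Condition 3: there are vertices $x,y$ of $G$ such that for every $i\in\Gamma(b)$,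 either ($v_i=x$, $w_i=y$) or ($v_i=y$, $w_i=x$). -}

module Defs where

open import Data.Nat using (ℕ)
open import Data.Fin using (Fin; zero; suc)
open import Data.Product using (Σ; _×_; _,_; ∃)
open import Data.Sum using (_⊎_)
open import Relation.Binary.PropositionalEquality using (_≡_; _≢_)
open import Relation.Nullary using (¬_)

-- The paper's index set {1,…,2k} is represented by Fin k × Fin 2:
-- position (e , zero) stands for 2e-1 and (e , suc zero) for 2e
-- (with e counted from 1 in the paper, from 0 here).
-- So an oriented graph H on vertices Fin t with k edges is given by
--   a : Fin k → Fin 2 → Fin t,   edge e is  a e 0 → a e 1.
-- Likewise the 2k-tuple T = (T1 , T2) of directed edges of the symmetric
-- digraph of G is given by v w : Fin k → Fin 2 → Fin n, where
-- v e 0 → v e 1 is the e-th entry of T1 and w e 0 → w e 1 that of T2.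

Pos : ℕ → Set
Pos k = Fin k × Fin 2

Γ : ∀ {t k} → (Fin k → Fin 2 → Fin t) → Fin t → Pos k → Set
Γ a b (e , s) = a e s ≡ b

Incident : ∀ {t k} → (Fin k → Fin 2 → Fin t) → Fin k → Fin t → Set
Incident a e b = Σ (Fin 2) λ s → a e s ≡ b

IsSimpleOriented : ∀ {t k} → (Fin k → Fin 2 → Fin t) → Set
IsSimpleOriented {t} {k} a =
  (∀ e → a e zero ≢ a e (suc zero)) ×
  (∀ e e' → ((a e zero ≡ a e' zero × a e (suc zero) ≡ a e' (suc zero)) ⊎
             (a e zero ≡ a e' (suc zero) × a e (suc zero) ≡ a e' zero))
          → e ≡ e')

data HReach {t k : ℕ} (a : Fin k → Fin 2 → Fin t) : Fin t → Fin t → Set where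
  here : ∀ {b} → HReach a b b
  fwd  : ∀ {b} e → HReach a b (a e zero) → HReach a b (a e (suc zero))
  bwd  : ∀ {b} e → HReach a b (a e (suc zero)) → HReach a b (a e zero)

IsConnected : ∀ {t k} → (Fin k → Fin 2 → Fin t) → Set
IsConnected {t} a = ∀ (b c : Fin t) → HReach a b c

NoLeaves : ∀ {t k} → (Fin k → Fin 2 → Fin t) → Set
NoLeaves {t} {k} a =
  ∀ (b : Fin t) (e : Fin k) → Incident a e b →
    Σ (Fin k) λ e' → e' ≢ e × Incident a e' b

record SimpleGraph (n : ℕ) : Set₁ where
  field
    Adj    : Fin n → Fin n → Set
    sym    : ∀ {x y} → Adj x y → Adj y x
    irrefl : ∀ {x} → ¬ Adj x x

IsEdgeTuple : ∀ {n k} → SimpleGraph n → (Fin k → Fin 2 → Fin n) → Set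
IsEdgeTuple G v = ∀ e → SimpleGraph.Adj G (v e zero) (v e (suc zero))

Cond1 : ∀ {t k n} → (Fin k → Fin 2 → Fin t) →
        (v w : Fin k → Fin 2 → Fin n) → Fin t → Set
Cond1 a v w b = ∀ (p q : Pos _) → Γ a b p → Γ a b q →
  (v (Data.Product.proj₁ p) (Data.Product.proj₂ p) ≡ v (Data.Product.proj₁ q) (Data.Product.proj₂ q)) ×
  (w (Data.Product.proj₁ p) (Data.Product.proj₂ p) ≡ w (Data.Product.proj₁ q) (Data.Product.proj₂ q))

Cond2 : ∀ {t k n} → (Fin k → Fin 2 → Fin t) →
        (v w : Fin k → Fin 2 → Fin n) → Fin t → Set
Cond2 a v w b = ∀ (e : Fin _) (s : Fin 2) → Γ a b (e , s) → v e s ≡ w e s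

Cond3 : ∀ {t k n} → (Fin k → Fin 2 → Fin t) →
        (v w : Fin k → Fin 2 → Fin n) → Fin t → Set
Cond3 {n = n} a v w b = Σ (Fin n) λ x → Σ (Fin n) λ y →
  ∀ (e : Fin _) (s : Fin 2) → Γ a b (e , s) →
    (v e s ≡ x × w e s ≡ y) ⊎ (v e s ≡ y × w e s ≡ x)

-- K : the undirected subgraph of G with edges v_{2i-1}v_{2i}, w_{2i-1}w_{2i}.
-- Reachability in K:

data KReach {k n : ℕ} (v w : Fin k → Fin 2 → Fin n) : Fin n → Fin n → Set where
  here  : ∀ {x} → KReach v w x x
  vfwd  : ∀ {x} e → KReach v w x (v e zero) → KReach v w x (v e (suc zero))
  vbwd  : ∀ {x} e → KReach v w x (v e (suc zero)) → KReach v w x (v e zero)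
  wfwd  : ∀ {x} e → KReach v w x (w e zero) → KReach v w x (w e (suc zero))
  wbwd  : ∀ {x} e → KReach v w x (w e (suc zero)) → KReach v w x (w e zero)

-- A connected component J of K is specified by a vertex r of K
-- (an endpoint of some edge of K): J consists of all edges of K
-- whose endpoints are reachable from r in K.
IsVertexOfK : ∀ {k n} → (v w : Fin k → Fin 2 → Fin n) → Fin n → Set
IsVertexOfK v w r =
  Σ (Fin _) λ e → Σ (Fin 2) λ s → (v e s ≡ r) ⊎ (w e s ≡ r)

-- edge e of H belongs to J' : v_{2e-1}v_{2e} or w_{2e-1}w_{2e} is an edge of J
-- (an edge of K lies in J iff its endpoint is reachable from r)
InJ' : ∀ {k n} → (v w : Fin k → Fin 2 → Fin n) → Fin n → Fin k → Set
InJ' v w r e = KReach v w r (v e zero) ⊎ KReach v w r (w e zero)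

VertexOfJ' : ∀ {t k n} → (Fin k → Fin 2 → Fin t) →
             (v w : Fin k → Fin 2 → Fin n) → Fin n → Fin t → Set
VertexOfJ' a v w r b = Σ (Fin _) λ e → InJ' v w r e × Incident a e b

DegJ'≥2 : ∀ {t k n} → (Fin k → Fin 2 → Fin t) →
          (v w : Fin k → Fin 2 → Fin n) → Fin n → Fin t → Set
DegJ'≥2 a v w r b = Σ (Fin _) λ e → Σ (Fin _) λ e' → e ≢ e' ×
  (InJ' v w r e × Incident a e b) × (InJ' v w r e' × Incident a e' b)

DegH≥3 : ∀ {t k} → (Fin k → Fin 2 → Fin t) → Fin t → Set
DegH≥3 a b = Σ (Fin _) λ e₁ → Σ (Fin _) λ e₂ → Σ (Fin _) λ e₃ →
  e₁ ≢ e₂ × e₁ ≢ e₃ × e₂ ≢ e₃ ×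
  Incident a e₁ b × Incident a e₂ b × Incident a e₃ b

-- Call a vertex b of H transparent if Condition 2 fails at b.  Condition 1 or 3 then holds, and
-- either way the unordered pair {v_i, w_i} is the same for all i ∈ Γ(b); so if one edge at b
-- lies in J', all edges at b do.  Starting on an edge of J', walk through H, passing straight
-- through transparent vertices of degree 2 (H has no leaves, so every other vertex has degree
-- at least 3).  This walk must stop: a closed walk through vertices of degree 2 of the
-- connected graph H visits every vertex, among them one satisfying Condition 2.  It stops
-- either at a vertex of degree ≥ 3 satisfying Condition 1 or 3, giving (iii), or at a vertex
-- satisfying Condition 2.  In the latter case walk back from that vertex along the edge just
-- used.  Again this ends in (iii) or at a Condition-2 vertex, and it cannot end by re-entering
-- the first stopping vertex along the same edge: a walk through degree-2 vertices that ends at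
-- the reversal of its first step would have to turn around halfway.  So the second stopping
-- vertex is a different one, giving (i), or the same one reached along another edge of J',
-- giving (ii).

module Submission where

open import Defs
open import Data.Nat using (ℕ; zero; suc; _+_; _*_; _≤_; _<_; z≤n; s≤s)
open import Data.Nat.Properties
  using (≤-pred; <-trans; <-≤-trans; n<1+n; n≤1+n; m≤n⇒m≤1+n; m<1+n⇒m<n∨m≡n; +-suc; m≤n⇒∃[o]m+o≡n)
open import Data.Nat.GeneralisedArithmetic using (iterate)
open import Data.Fin using (Fin; zero; suc; toℕ; _≟_; combine; opposite)
open import Data.Fin.Properties
  using (all?; any?; pigeonhole; toℕ<n; combine-injective; opposite-involutive)
open import Data.Product using (Σ; ∃; _×_; _,_; proj₁; proj₂)
open import Data.Sum using (_⊎_; inj₁; inj₂; swap; [_,_]′; map₂)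
import Data.Sum as Sum
open import Data.Empty using (⊥-elim)
open import Function using (id; _∘_)
open import Relation.Nullary using (¬_; Dec; yes; no)
open import Relation.Nullary.Decidable using (¬?; _×-dec_; _→-dec_)
open import Relation.Binary.PropositionalEquality
  using (_≡_; _≢_; refl; sym; trans; cong; subst; ≢-sym; module ≡-Reasoning)

module Iteration {A : Set} (next : A → A) where

  walk : A → ℕ → A
  walk = iterate next

  walk-suc : ∀ s l → walk s (suc l) ≡ next (walk s l)
  walk-suc s zero    = refl
  walk-suc s (suc l) = walk-suc (next s) l

  walk-+ : ∀ s m {l} → walk s (m + l) ≡ walk (walk s m) l
  walk-+ s zero    = refl
  walk-+ s (suc m) = walk-+ (next s) m

  walk-repeats : ∀ {N} (encode : A → Fin N) → (∀ {x y} → encode x ≡ encode y → x ≡ y) →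
                 ∀ s → ∃ λ i → ∃ λ p → i + suc p ≤ N × walk (walk s i) (suc p) ≡ walk s i
  walk-repeats {N} encode encode-injective s
    with i , j , i<j , same ← pigeonhole (n<1+n N) (λ i → encode (walk s (toℕ i)))
    with p , i+1+p≡j ← m≤n⇒∃[o]m+o≡n i<j
    = toℕ i , p , subst (_≤ N) (sym i+1+p≡j′) (≤-pred (toℕ<n j)) , closes
    where
      open ≡-Reasoning
      i+1+p≡j′ : toℕ i + suc p ≡ toℕ j
      i+1+p≡j′ = trans (+-suc (toℕ i) p) i+1+p≡j
      closes : walk (walk s (toℕ i)) (suc p) ≡ walk s (toℕ i)
      closes = begin
        walk (walk s (toℕ i)) (suc p) ≡⟨ walk-+ s (toℕ i) ⟨
        walk s (toℕ i + suc p)        ≡⟨ cong (walk s) i+1+p≡j′ ⟩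
        walk s (toℕ j)                ≡⟨ encode-injective same ⟨
        walk s (toℕ i)                ∎

  record Run (R : A → A → Set) (s : A) (m : ℕ) : Set where
    constructor mkRun
    field hop : ∀ l → l < m → R (walk s l) (walk s (suc l))

  open Run public

  module _ {R : A → A → Set} where

    Run-map : ∀ {S : A → A → Set} → (∀ {x y} → R x y → S x y) → ∀ {s m} → Run R s m → Run S s m
    Run-map f run = mkRun λ l l<m → f (hop run l l<m)

    Run-weaken : ∀ {s m n} → m ≤ n → Run R s n → Run R s m
    Run-weaken m≤n run = mkRun λ l l<m → hop run l (<-≤-trans l<m m≤n)

    Run-tail : ∀ {s m} → Run R s (suc m) → Run R (next s) m
    Run-tail run = mkRun λ l l<m → hop run (suc l) (s≤s l<m)

    Run-drop : ∀ {s} m {l} → Run R s (m + l) → Run R (walk s m) l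
    Run-drop zero    run = run
    Run-drop (suc m) run = Run-drop m (Run-tail run)

    Run-snoc : ∀ {s m} → Run R s m → R (walk s m) (walk s (suc m)) → Run R s (suc m)
    Run-snoc {s} {m} run last = mkRun extended
      where
        extended : ∀ l → l < suc m → R (walk s l) (walk s (suc l))
        extended l l<1+m with m<1+n⇒m<n∨m≡n l<1+m
        ... | inj₁ l<m  = hop run l l<m
        ... | inj₂ refl = last

    Run-invariant : ∀ {P : A → Set} → (∀ {x y} → R x y → P x → P y) →
                    ∀ {s} m → Run R s m → P s → P (walk s m)
    Run-invariant pres zero    run ps = ps
    Run-invariant pres (suc m) run ps = Run-invariant pres m (Run-tail run) (pres (hop run 0 (s≤s z≤n)) ps)

    run-until : ∀ {Stop : A → Set} → (∀ x → Stop x ⊎ R x (next x)) →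
                ∀ s m → (∃ λ l → Run R s l × Stop (walk s l)) ⊎ Run R s m
    run-until step s zero = inj₂ (mkRun λ l ())
    run-until step s (suc m) with run-until step s m
    ... | inj₁ stopped = inj₁ stopped
    ... | inj₂ run with step (walk s m)
    ...   | inj₁ stop = inj₁ (m , run , stop)
    ...   | inj₂ last = inj₂ (Run-snoc run (subst (R (walk s m)) (sym (walk-suc s m)) last))

module Darts {t k : ℕ} (a : Fin k → Fin 2 → Fin t) (loopless : ∀ e → a e zero ≢ a e (suc zero)) where

  Dart : Set
  Dart = Pos k

  head tail : Dart → Fin t
  head (e , d) = a e d
  tail (e , d) = a e (opposite d)

  reverse : Dart → Dart
  reverse (e , d) = e , opposite d

  reverse-involutive : ∀ s → reverse (reverse s) ≡ s
  reverse-involutive (e , d) = cong (e ,_) (opposite-involutive d)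

  reverse-injective : ∀ {s s′} → reverse s ≡ reverse s′ → s ≡ s′
  reverse-injective {s} {s′} eq =
    trans (sym (reverse-involutive s)) (trans (cong reverse eq) (reverse-involutive s′))

  reverse-≢ : ∀ s → reverse s ≢ s
  reverse-≢ (e , zero)     ()
  reverse-≢ (e , suc zero) ()

  tail-reverse : ∀ s → tail (reverse s) ≡ head s
  tail-reverse (e , d) = cong (a e) (opposite-involutive d)

  a-injective : ∀ e {d d′} → a e d ≡ a e d′ → d ≡ d′
  a-injective e {zero}     {zero}     _  = refl
  a-injective e {zero}     {suc zero} eq = ⊥-elim (loopless e eq)
  a-injective e {suc zero} {zero}     eq = ⊥-elim (loopless e (sym eq))
  a-injective e {suc zero} {suc zero} _  = refl

  same-dart : ∀ {s s′} → proj₁ s ≡ proj₁ s′ → head s ≡ head s′ → s ≡ s′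
  same-dart {e , d} {.e , d′} refl heads≡ = cong (e ,_) (a-injective e heads≡)

  other-end : ∀ {e d} s → e ≡ proj₁ s → a e d ≡ head s → a e (opposite d) ≡ tail s
  other-end (e , d′) refl at = cong (a e ∘ opposite) (a-injective e at)

  encode : Dart → Fin (k * 2)
  encode (e , d) = combine e d

  encode-injective : ∀ {s s′} → encode s ≡ encode s′ → s ≡ s′
  encode-injective {e , d} {e′ , d′} eq with refl , refl ← combine-injective e d e′ d′ eq = refl

  record _⇒_ (s s′ : Dart) : Set where
    field
      leaves : tail s′ ≡ head s
      turns  : proj₁ s′ ≢ proj₁ s
      only   : ∀ e d → a e d ≡ head s → e ≡ proj₁ s ⊎ e ≡ proj₁ s′

  open _⇒_ public

  ⇒-deterministic : ∀ {s s₁ s₂} → s ⇒ s₁ → s ⇒ s₂ → s₁ ≡ s₂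
  ⇒-deterministic {s} {e₁ , d₁} {e₂ , d₂} step₁ step₂ with only step₁ e₂ (opposite d₂) (leaves step₂)
  ... | inj₁ e₂≡ = ⊥-elim (turns step₂ e₂≡)
  ... | inj₂ refl = reverse-injective (same-dart refl (trans (leaves step₁) (sym (leaves step₂))))

  ⇒-reverse : ∀ {s s′} → s ⇒ s′ → reverse s′ ⇒ reverse s
  ⇒-reverse {s} step = record
    { leaves = trans (tail-reverse s) (sym (leaves step))
    ; turns  = turns step ∘ sym
    ; only   = λ e d at → swap (only step e d (trans at (leaves step)))
    }

  ⇒-or-deg≥3 : NoLeaves a → ∀ s → DegH≥3 a (head s) ⊎ ∃ (s ⇒_)
  ⇒-or-deg≥3 noLeaves (e , d)
    with e′ , e′≢e , d′ , at′ ← noLeaves (a e d) e (d , refl)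
    with any? (λ e″ → ¬? (e″ ≟ e) ×-dec ¬? (e″ ≟ e′) ×-dec any? (λ d″ → a e″ d″ ≟ a e d))
  ... | yes (e″ , e″≢e , e″≢e′ , at″) =
    inj₁ (e , e′ , e″ , ≢-sym e′≢e , ≢-sym e″≢e , ≢-sym e″≢e′ , (d , refl) , (d′ , at′) , at″)
  ... | no ¬third = inj₂ ((e′ , opposite d′) , record
    { leaves = trans (cong (a e′) (opposite-involutive d′)) at′
    ; turns  = e′≢e
    ; only   = only-two
    })
    where
      only-two : ∀ e″ d″ → a e″ d″ ≡ a e d → e″ ≡ e ⊎ e″ ≡ e′
      only-two e″ d″ at″ with e″ ≟ e | e″ ≟ e′
      ... | yes e″≡e | _          = inj₁ e″≡e
      ... | no _     | yes e″≡e′  = inj₂ e″≡e′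
      ... | no e″≢e  | no e″≢e′   = ⊥-elim (¬third (e″ , e″≢e , e″≢e′ , d″ , at″))

  module Trails (next : Dart → Dart) where

    open Iteration next

    -- Peeling off the first and the last step leaves, by determinism, a run that again ends
    -- at the reversal of its start.
    no-reversal : ∀ s m → Run _⇒_ s m → walk s m ≢ reverse s
    no-reversal s zero          run ends = reverse-≢ s (sym ends)
    no-reversal s (suc zero)    run ends = turns (hop run 0 (s≤s z≤n)) (cong proj₁ ends)
    no-reversal s (suc (suc m)) run ends =
      no-reversal (next s) m (Run-weaken (n≤1+n m) (Run-tail run)) ends′
      where
        last-reversed : s ⇒ reverse (walk s (suc m))
        last-reversed = subst (_⇒ reverse (walk s (suc m))) (reverse-involutive s)
          (⇒-reverse (subst (walk s (suc m) ⇒_) ends (hop run (suc m) (n<1+n (suc m)))))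
        ends′ : walk s (suc m) ≡ reverse (next s)
        ends′ = trans (sym (reverse-involutive _))
                      (cong reverse (⇒-deterministic last-reversed (hop run 0 (s≤s z≤n))))

    closed-walk-visits : IsConnected a → ∀ s p → Run _⇒_ s (suc p) → walk s (suc p) ≡ s →
                         ∀ c → ∃ λ l → l < suc p × head (walk s l) ≡ c
    closed-walk-visits connected s p run closed c = visits (connected (head s) c)
      where
        Visited : Fin t → Set
        Visited c = ∃ λ l → l < suc p × head (walk s l) ≡ c

        tail-visited : ∀ l → l < suc p → Visited (tail (walk s l))
        tail-visited zero    _     = p , n<1+n p , trans (sym (leaves (hop run p (n<1+n p)))) (cong tail closed)
        tail-visited (suc l) l<1+p = l , l<1+p′ , sym (leaves (hop run l l<1+p′))
          where
            l<1+p′ : l < suc p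
            l<1+p′ = <-trans (n<1+n l) l<1+p

        next-head-visited : ∀ l → l < suc p → Visited (head (walk s (suc l)))
        next-head-visited l l<1+p with m<1+n⇒m<n∨m≡n l<1+p
        ... | inj₁ l<p  = suc l , s≤s l<p , refl
        ... | inj₂ refl = 0 , s≤s z≤n , cong head (sym closed)

        across : ∀ {e d} → Visited (a e d) → Visited (a e (opposite d))
        across {e} {d} (l , l<1+p , at) with only (hop run l l<1+p) e d (sym at)
        ... | inj₁ e≡ = subst Visited (sym (other-end (walk s l) e≡ (sym at))) (tail-visited l l<1+p)
        ... | inj₂ e≡ = subst Visited (sym (trans (other-end (reverse s₊) e≡ at′) (tail-reverse s₊)))
                              (next-head-visited l l<1+p)
          where
            s₊ : Dart
            s₊ = walk s (suc l)
            at′ : a e d ≡ tail s₊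
            at′ = trans (sym at) (sym (leaves (hop run l l<1+p)))

        visits : ∀ {c} → HReach a (head s) c → Visited c
        visits here      = 0 , s≤s z≤n , refl
        visits (fwd e h) = across (visits h)
        visits (bwd e h) = across (visits h)

SamePair : ∀ {A : Set} → A → A → A → A → Set
SamePair x y x′ y′ = (x ≡ x′ × y ≡ y′) ⊎ (x ≡ y′ × y ≡ x′)

samePair-via : ∀ {A : Set} {x y x′ y′ z z′ : A} →
               SamePair x y z z′ → SamePair x′ y′ z z′ → SamePair x y x′ y′
samePair-via (inj₁ (p , q)) (inj₁ (p′ , q′)) = inj₁ (trans p (sym p′) , trans q (sym q′))
samePair-via (inj₁ (p , q)) (inj₂ (p′ , q′)) = inj₂ (trans p (sym q′) , trans q (sym p′))
samePair-via (inj₂ (p , q)) (inj₁ (p′ , q′)) = inj₂ (trans p (sym q′) , trans q (sym p′))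
samePair-via (inj₂ (p , q)) (inj₂ (p′ , q′)) = inj₁ (trans p (sym p′) , trans q (sym q′))

samePair-transport : ∀ {A : Set} (P : A → Set) {x y x′ y′ : A} →
                     SamePair x y x′ y′ → P x ⊎ P y → P x′ ⊎ P y′
samePair-transport P (inj₁ (refl , refl)) = id
samePair-transport P (inj₂ (refl , refl)) = swap

module Component {t k n : ℕ} (a : Fin k → Fin 2 → Fin t) (v w : Fin k → Fin 2 → Fin n) (r : Fin n) where

  EndInJ : Fin k → Fin 2 → Set
  EndInJ e d = KReach v w r (v e d) ⊎ KReach v w r (w e d)

  InJ'⇒EndInJ : ∀ {e} → InJ' v w r e → ∀ d → EndInJ e d
  InJ'⇒EndInJ j zero       = j
  InJ'⇒EndInJ j (suc zero) = Sum.map (vfwd _) (wfwd _) j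

  EndInJ⇒InJ' : ∀ {e} d → EndInJ e d → InJ' v w r e
  EndInJ⇒InJ' zero       j = j
  EndInJ⇒InJ' (suc zero) j = Sum.map (vbwd _) (wbwd _) j

  root-InJ' : ∀ {e d} → v e d ≡ r ⊎ w e d ≡ r → InJ' v w r e
  root-InJ' {d = d} at-r = EndInJ⇒InJ' d (Sum.map reached reached at-r)
    where
      reached : ∀ {x} → x ≡ r → KReach v w r x
      reached refl = here

  cond13-samePair : ∀ {b e d e′ d′} → Cond1 a v w b ⊎ Cond3 a v w b → a e d ≡ b → a e′ d′ ≡ b →
                    SamePair (v e d) (w e d) (v e′ d′) (w e′ d′)
  cond13-samePair {e = e} {d} {e′} {d′} (inj₁ c1)          at at′ = inj₁ (c1 (e , d) (e′ , d′) at at′)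
  cond13-samePair {e = e} {d} {e′} {d′} (inj₂ (_ , _ , c3)) at at′ = samePair-via (c3 e d at) (c3 e′ d′ at′)

  InJ'-across : ∀ {b e d e′ d′} → Cond1 a v w b ⊎ Cond3 a v w b → a e d ≡ b → a e′ d′ ≡ b →
                InJ' v w r e → InJ' v w r e′
  InJ'-across {d = d} {d′ = d′} c13 at at′ j =
    EndInJ⇒InJ' d′ (samePair-transport (KReach v w r) (cond13-samePair c13 at at′) (InJ'⇒EndInJ j d))

module Lemma3p7 {t k n : ℕ} (a : Fin k → Fin 2 → Fin t) (v w : Fin k → Fin 2 → Fin n)
    (loopless : ∀ e → a e zero ≢ a e (suc zero)) (connected : IsConnected a) (noLeaves : NoLeaves a)
    (cond : ∀ b → Cond1 a v w b ⊎ Cond2 a v w b ⊎ Cond3 a v w b)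
    (b₀ : Fin t) (cond2-b₀ : Cond2 a v w b₀) (r : Fin n) where

  open Darts a loopless
  open Component a v w r

  Cond13 : Fin t → Set
  Cond13 b = Cond1 a v w b ⊎ Cond3 a v w b

  cond2? : ∀ b → Dec (Cond2 a v w b)
  cond2? b = all? λ e → all? λ d → (a e d ≟ b) →-dec (v e d ≟ w e d)

  cond13-unless-cond2 : ∀ b → ¬ Cond2 a v w b → Cond13 b
  cond13-unless-cond2 b ¬c2 = map₂ [ ⊥-elim ∘ ¬c2 , id ]′ (cond b)

  Passes : Dart → Dart → Set
  Passes s s′ = s ⇒ s′ × ¬ Cond2 a v w (head s) × Cond13 (head s)

  Stop : Dart → Set
  Stop s = Cond2 a v w (head s) ⊎ (DegH≥3 a (head s) × Cond13 (head s))

  step : ∀ s → Σ Dart λ s′ → Stop s ⊎ Passes s s′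
  step s with cond2? (head s)
  ... | yes c2 = s , inj₁ (inj₁ c2)
  ... | no ¬c2 with ⇒-or-deg≥3 noLeaves s
  ...   | inj₁ deg           = s , inj₁ (inj₂ (deg , cond13-unless-cond2 _ ¬c2))
  ...   | inj₂ (s′ , s⇒s′)   = s′ , inj₂ (s⇒s′ , ¬c2 , cond13-unless-cond2 _ ¬c2)

  next : Dart → Dart
  next = proj₁ ∘ step

  open Iteration next
  open Trails next

  no-long-run : ∀ s → ¬ Run Passes s (suc (k * 2))
  no-long-run s run =
    let i , p , fits , closed = walk-repeats encode encode-injective s
        cycle = Run-drop i (Run-weaken (m≤n⇒m≤1+n fits) run)
        l , l<1+p , at-b₀ = closed-walk-visits connected (walk s i) p (Run-map proj₁ cycle) closed b₀
    in proj₁ (proj₂ (hop cycle l l<1+p)) (subst (Cond2 a v w) (sym at-b₀) cond2-b₀)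

  reaches-stop : ∀ s → ∃ λ m → Run Passes s m × Stop (walk s m)
  reaches-stop s with run-until (proj₂ ∘ step) s (suc (k * 2))
  ... | inj₁ stopped = stopped
  ... | inj₂ run     = ⊥-elim (no-long-run s run)

  InJ'-along : ∀ {s} m → Run Passes s m → InJ' v w r (proj₁ s) → InJ' v w r (proj₁ (walk s m))
  InJ'-along = Run-invariant (λ (s⇒s′ , _ , c13) → InJ'-across c13 refl (leaves s⇒s′))

  Conclusion : Set
  Conclusion =
    (Σ (Fin t) λ b₁ → Σ (Fin t) λ b₂ → b₁ ≢ b₂ ×
        (VertexOfJ' a v w r b₁ × Cond2 a v w b₁) ×
        (VertexOfJ' a v w r b₂ × Cond2 a v w b₂))
    ⊎ (Σ (Fin t) λ b → DegJ'≥2 a v w r b × Cond2 a v w b)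
    ⊎ (Σ (Fin t) λ b → VertexOfJ' a v w r b × DegH≥3 a b × Cond13 b)

  head-∈J' : ∀ s → InJ' v w r (proj₁ s) → VertexOfJ' a v w r (head s)
  head-∈J' s s∈J' = proj₁ s , s∈J' , proj₂ s , refl

  deg≥3-end : ∀ s → InJ' v w r (proj₁ s) → DegH≥3 a (head s) → Cond13 (head s) → Conclusion
  deg≥3-end s s∈J' deg c13 = inj₂ (inj₂ (head s , head-∈J' s s∈J' , deg , c13))

  distinct-cond2-ends : ∀ f g → InJ' v w r (proj₁ f) → InJ' v w r (proj₁ g) →
                        Cond2 a v w (head f) → Cond2 a v w (head g) → g ≢ f → Conclusion
  distinct-cond2-ends f g f∈J' g∈J' c2f c2g g≢f with head f ≟ head g
  ... | no heads≢ = inj₁ (head f , head g , heads≢ , (head-∈J' f f∈J' , c2f) , (head-∈J' g g∈J' , c2g))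
  ... | yes heads≡ with proj₁ f ≟ proj₁ g
  ...   | no edges≢ = inj₂ (inj₁ (head f ,
            (proj₁ f , proj₁ g , edges≢ , (f∈J' , proj₂ f , refl) , (g∈J' , proj₂ g , sym heads≡)) , c2f))
  ...   | yes edges≡ = ⊥-elim (g≢f (same-dart (sym edges≡) (sym heads≡)))

  from-cond2-end : ∀ f → InJ' v w r (proj₁ f) → Cond2 a v w (head f) → Conclusion
  from-cond2-end f f∈J' c2f with reaches-stop (reverse f)
  ... | m , run , inj₂ (deg , c13) = deg≥3-end _ (InJ'-along m run f∈J') deg c13
  ... | m , run , inj₁ c2g = distinct-cond2-ends f _ f∈J' (InJ'-along m run f∈J') c2f c2g
          λ g≡f → no-reversal (reverse f) m (Run-map proj₁ run) (trans g≡f (sym (reverse-involutive f)))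

  conclusion : IsVertexOfK v w r → Conclusion
  conclusion (e₀ , d₀ , at-r) with reaches-stop (e₀ , zero)
  ... | m , run , inj₂ (deg , c13) = deg≥3-end _ (InJ'-along m run (root-InJ' at-r)) deg c13
  ... | m , run , inj₁ c2          = from-cond2-end _ (InJ'-along m run (root-InJ' at-r)) c2

lemma3p7 : ∀ {t k n : ℕ} (a : Fin k → Fin 2 → Fin t) (G : SimpleGraph n)
    (v w : Fin k → Fin 2 → Fin n) →
    IsSimpleOriented a → IsConnected a → NoLeaves a →
    IsEdgeTuple G v → IsEdgeTuple G w →
    (∀ (b : Fin t) → Cond1 a v w b ⊎ Cond2 a v w b ⊎ Cond3 a v w b) →
    Σ (Fin t) (λ b → Cond2 a v w b) →
    (r : Fin n) → IsVertexOfK v w r →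
    (Σ (Fin t) λ b₁ → Σ (Fin t) λ b₂ → b₁ ≢ b₂ ×
        (VertexOfJ' a v w r b₁ × Cond2 a v w b₁) ×
        (VertexOfJ' a v w r b₂ × Cond2 a v w b₂))
    ⊎ (Σ (Fin t) λ b → DegJ'≥2 a v w r b × Cond2 a v w b)
    ⊎ (Σ (Fin t) λ b → VertexOfJ' a v w r b × DegH≥3 a b ×
        (Cond1 a v w b ⊎ Cond3 a v w b))
lemma3p7 a G v w (loopless , _) connected noLeaves _ _ cond (b₀ , cond2-b₀) r r∈K =
  Lemma3p7.conclusion a v w loopless connected noLeaves cond b₀ cond2-b₀ r r∈K
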